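{- Let $D$ be a finite twin-free digraph. Then $\overrightarrow{\gamma^{\mathrm{S}}}(D)\le |V(D)|-1$.
   Context: Digraphs have no loops or multiple arcs. For a vertex $u$ of a digraph $D$, $B_1^+(u)$ is the set consisting of $u$ and all vertices $w$ with an arc from $w$ to $u$. Two vertices $u\neq v$ are twins if $B_1^+(u)=B_1^+(v)$; $D$ is twin-free if it has no twins. A separating code of $D$ is a set $C\subseteq V(D)$ such that $B_1^+(u)\cap C\neq B_1^+(v)\cap C$ for all distinct $u,v\in V(D)$. $\overrightarrow{\gamma^{\mathrm{S}}}(D)$ denotes the minimum size of a separating code of $D$. -}

module Defs where

open import Data.Nat using (ℕ; _≤_; _∸_)
open import Data.Fin using (Fin)
open import Data.Fin.Subset using (Subset; _∈_; ∣_∣)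
open import Data.Sum using (_⊎_)
open import Data.Product using (_×_; Σ-syntax)
open import Relation.Nullary using (¬_; Dec)
open import Relation.Binary.PropositionalEquality using (_≡_)
open import Function.Bundles using (_⇔_)

-- A finite digraph on vertex set Fin n: an arc relation, no loops.
-- (No multiple arcs is automatic: arcs form a relation.)
record Digraph (n : ℕ) : Set₁ where
  field
    Arc      : Fin n → Fin n → Set
    loopless : ∀ u → ¬ Arc u u
    arc?     : ∀ u v → Dec (Arc u v)

open Digraph public

InBall : ∀ {n} → Digraph n → Fin n → Fin n → Set
InBall D w u = (w ≡ u) ⊎ Arc D w u

Twins : ∀ {n} → Digraph n → Fin n → Fin n → Set
Twins D u v = ¬ (u ≡ v) × (∀ w → InBall D w u ⇔ InBall D w v)

TwinFree : ∀ {n} → Digraph n → Set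
TwinFree D = ∀ u v → ¬ Twins D u v

SameTrace : ∀ {n} → Digraph n → Subset n → Fin n → Fin n → Set
SameTrace D C u v = ∀ w → w ∈ C → (InBall D w u ⇔ InBall D w v)

IsSeparatingCode : ∀ {n} → Digraph n → Subset n → Set
IsSeparatingCode D C = ∀ u v → ¬ (u ≡ v) → ¬ SameTrace D C u v

-- Write B₁⁺(u) as a 0/1 vector indexed by the vertices; twin-freeness says these n vectors are
-- pairwise distinct, and a separating code is a set of coordinates on which they stay distinct.
-- Any k distinct vectors are separated by k − 1 coordinates: pick a coordinate w on which two of
-- them differ, split the vectors by their value at w into two nonempty groups of sizes k₁ + k₀ = k,
-- separate each group recursively, and add w, for 1 + (k₁ − 1) + (k₀ − 1) = k − 1 coordinates.
module Submission where

open import Defs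
open import Data.Bool using (Bool)
open import Data.Bool.Properties using () renaming (_≟_ to _≟ᵇ_)
open import Data.Empty using (⊥-elim)
open import Data.Fin using (Fin; _≟_)
open import Data.Fin.Properties using (any?)
open import Data.Fin.Subset using (Subset; _⊆_; ⊥; ⁅_⁆; _∪_; ∣_∣; inside; outside) renaming (_∈_ to _∈ₛ_)
open import Data.Fin.Subset.Properties using (∣⊥∣≡0; ∣⁅x⁆∣≡1; x∈⁅x⁆; p⊆p∪q; q⊆p∪q; ⊆-trans)
open import Data.List using (List; []; _∷_; length; filter; allFin)
open import Data.List.Properties using (filter-some; length-tabulate)
open import Data.List.Membership.Propositional using (_∈_; find; lose)
open import Data.List.Membership.Propositional.Properties using (∈-filter⁺; ∈-allFin)
open import Data.List.Relation.Unary.Any as Any using (here)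
open import Data.Nat using (ℕ; zero; suc; _+_; _∸_; _≤_; _<_; z≤n; s≤s)
open import Data.Nat.Properties
  using (≤-refl; ≤-reflexive; ≤-trans; +-suc; +-mono-≤; +-monoʳ-≤; n≤1+n; m+n≤o⇒m≤o; m+n≤o⇒n≤o; module ≤-Reasoning)
open import Data.Product using (Σ-syntax; _×_; _,_; proj₁; proj₂)
open import Data.Vec using ([]; _∷_)
open import Function using (_∘_; id)
open import Function.Bundles using (_⇔_; mk⇔)
open import Relation.Nullary using (Dec; yes; no; does; ¬?)
open import Relation.Nullary.Decidable using (_⊎-dec_; does-⇔; decidable-stable)
open import Relation.Unary.Properties using (∁?)
open import Relation.Binary.PropositionalEquality using (_≡_; refl; sym; trans; cong; subst)

∣p∪q∣≤∣p∣+∣q∣ : ∀ {n} (p q : Subset n) → ∣ p ∪ q ∣ ≤ ∣ p ∣ + ∣ q ∣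
∣p∪q∣≤∣p∣+∣q∣ []            []            = z≤n
∣p∪q∣≤∣p∣+∣q∣ (inside ∷ p)  (inside ∷ q)  = s≤s (≤-trans (∣p∪q∣≤∣p∣+∣q∣ p q) (+-monoʳ-≤ ∣ p ∣ (n≤1+n ∣ q ∣)))
∣p∪q∣≤∣p∣+∣q∣ (inside ∷ p)  (outside ∷ q) = s≤s (∣p∪q∣≤∣p∣+∣q∣ p q)
∣p∪q∣≤∣p∣+∣q∣ (outside ∷ p) (inside ∷ q)  = subst (suc ∣ p ∪ q ∣ ≤_) (sym (+-suc ∣ p ∣ ∣ q ∣)) (s≤s (∣p∪q∣≤∣p∣+∣q∣ p q))
∣p∪q∣≤∣p∣+∣q∣ (outside ∷ p) (outside ∷ q) = ∣p∪q∣≤∣p∣+∣q∣ p q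

length-filter+length-filter-∁ : ∀ {a p} {A : Set a} {P : A → Set p} (P? : ∀ x → Dec (P x)) xs →
  length (filter P? xs) + length (filter (∁? P?) xs) ≡ length xs
length-filter+length-filter-∁ P? []       = refl
length-filter+length-filter-∁ P? (x ∷ xs) with P? x
... | yes _ = cong suc (length-filter+length-filter-∁ P? xs)
... | no  _ = trans (+-suc _ _) (cong suc (length-filter+length-filter-∁ P? xs))

does-≡⇒⇔ : ∀ {p q} {P : Set p} {Q : Set q} (p? : Dec P) (q? : Dec Q) → does p? ≡ does q? → P ⇔ Q
does-≡⇒⇔ (yes p) (yes q) _ = mk⇔ (λ _ → q) (λ _ → p)
does-≡⇒⇔ (no ¬p) (no ¬q) _ = mk⇔ (⊥-elim ∘ ¬p) (⊥-elim ∘ ¬q)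
does-≡⇒⇔ (yes _) (no _)  ()
does-≡⇒⇔ (no _)  (yes _) ()

private
  parts-shorter : ∀ {a b k} → 0 < a → 0 < b → a + b ≤ suc k → a ≤ k × b ≤ k
  parts-shorter {suc a} {suc b} {k} _ _ (s≤s a+1+b≤k) =
    m+n≤o⇒m≤o (suc a) (subst (_≤ k) (+-suc a b) a+1+b≤k) , m+n≤o⇒n≤o a a+1+b≤k

  suc-pred+pred : ∀ {a b} → 0 < a → 0 < b → suc (a ∸ 1 + (b ∸ 1)) ≡ a + b ∸ 1
  suc-pred+pred {suc a} {suc b} _ _ = sym (+-suc a b)

module SeparatingCoordinates {a} {A : Set a} {n : ℕ} (χ : A → Fin n → Bool)
  (χ-injective : ∀ {x y} → (∀ w → χ x w ≡ χ y w) → x ≡ y) where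

  AgreeOn : Subset n → A → A → Set
  AgreeOn C x y = ∀ {w} → w ∈ₛ C → χ x w ≡ χ y w

  Separates : Subset n → List A → Set a
  Separates C L = ∀ {x y} → x ∈ L → y ∈ L → AgreeOn C x y → x ≡ y

  agreeOn-⊆ : ∀ {C C′ x y} → C ⊆ C′ → AgreeOn C′ x y → AgreeOn C x y
  agreeOn-⊆ C⊆C′ agree w∈C = agree (C⊆C′ w∈C)

  ⊥-separates-constant : ∀ {x L} → (∀ {y} → y ∈ L → ∀ w → χ y w ≡ χ x w) → Separates ⊥ L
  ⊥-separates-constant constant y∈L z∈L _ =
    trans (χ-injective (constant y∈L)) (sym (χ-injective (constant z∈L)))

  module Split (w : Fin n) (b : Bool) where

    P? : ∀ x → Dec (χ x w ≡ b)
    P? x = χ x w ≟ᵇ b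

    split-separates : ∀ {C₁ C₀} L → Separates C₁ (filter P? L) → Separates C₀ (filter (∁? P?) L) →
                      Separates (⁅ w ⁆ ∪ (C₁ ∪ C₀)) L
    split-separates {C₁} {C₀} L sep₁ sep₀ {x} {y} x∈L y∈L agree with P? x
    ... | yes x↦b = sep₁ (∈-filter⁺ P? x∈L x↦b) (∈-filter⁺ P? y∈L (trans (sym agree-at-w) x↦b))
                         (agreeOn-⊆ (⊆-trans (p⊆p∪q C₀) (q⊆p∪q ⁅ w ⁆ _)) agree)
      where agree-at-w = agree (p⊆p∪q _ (x∈⁅x⁆ w))
    ... | no x↦̸b = sep₀ (∈-filter⁺ (∁? P?) x∈L x↦̸b) (∈-filter⁺ (∁? P?) y∈L (x↦̸b ∘ trans agree-at-w))
                         (agreeOn-⊆ (⊆-trans (q⊆p∪q C₁ C₀) (q⊆p∪q ⁅ w ⁆ _)) agree)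
      where agree-at-w = agree (p⊆p∪q _ (x∈⁅x⁆ w))

  separatingSubset : ∀ L → Σ[ C ∈ Subset n ] (∣ C ∣ ≤ length L ∸ 1 × Separates C L)
  separatingSubset L = go (length L) L ≤-refl
    where
    go : ∀ k L → length L ≤ k → Σ[ C ∈ Subset n ] (∣ C ∣ ≤ length L ∸ 1 × Separates C L)
    go _ [] _ = ⊥ , ≤-reflexive (∣⊥∣≡0 n) , λ ()
    go zero (_ ∷ _) ()
    go (suc k) L@(x ∷ _) |L|≤1+k with any? (λ w → Any.any? (λ y → ¬? (χ y w ≟ᵇ χ x w)) L)
    ... | no ¬split = ⊥ , ≤-trans (≤-reflexive (∣⊥∣≡0 n)) z≤n ,
          ⊥-separates-constant λ {y} y∈L w →
            decidable-stable (χ y w ≟ᵇ χ x w) (λ y≢x → ¬split (w , lose y∈L y≢x))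
    ... | yes (w , split) with find split
    ... | y , y∈L , y≢x = ⁅ w ⁆ ∪ (C₁ ∪ C₀) , size , split-separates L sep₁ sep₀
      where
      open Split w (χ x w)
      L₁ = filter P? L
      L₀ = filter (∁? P?) L
      lengths : length L₁ + length L₀ ≡ length L
      lengths = length-filter+length-filter-∁ P? L
      L₁-nonempty : 0 < length L₁
      L₁-nonempty = filter-some P? (here refl)
      L₀-nonempty : 0 < length L₀
      L₀-nonempty = filter-some (∁? P?) (lose y∈L y≢x)
      shorter = parts-shorter L₁-nonempty L₀-nonempty (subst (_≤ suc k) (sym lengths) |L|≤1+k)
      r₁ = go k L₁ (proj₁ shorter)
      r₀ = go k L₀ (proj₂ shorter)
      C₁ = proj₁ r₁
      C₀ = proj₁ r₀
      sep₁ = proj₂ (proj₂ r₁)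
      sep₀ = proj₂ (proj₂ r₀)
      size : ∣ ⁅ w ⁆ ∪ (C₁ ∪ C₀) ∣ ≤ length L ∸ 1
      size = begin
        ∣ ⁅ w ⁆ ∪ (C₁ ∪ C₀) ∣                 ≤⟨ ∣p∪q∣≤∣p∣+∣q∣ ⁅ w ⁆ (C₁ ∪ C₀) ⟩
        ∣ ⁅ w ⁆ ∣ + ∣ C₁ ∪ C₀ ∣               ≤⟨ +-mono-≤ (≤-reflexive (∣⁅x⁆∣≡1 w)) (∣p∪q∣≤∣p∣+∣q∣ C₁ C₀) ⟩
        suc (∣ C₁ ∣ + ∣ C₀ ∣)                 ≤⟨ s≤s (+-mono-≤ (proj₁ (proj₂ r₁)) (proj₁ (proj₂ r₀))) ⟩
        suc (length L₁ ∸ 1 + (length L₀ ∸ 1)) ≡⟨ suc-pred+pred L₁-nonempty L₀-nonempty ⟩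
        length L₁ + length L₀ ∸ 1             ≡⟨ cong (_∸ 1) lengths ⟩
        length L ∸ 1                          ∎
        where open ≤-Reasoning

inBall? : ∀ {n} (D : Digraph n) w u → Dec (InBall D w u)
inBall? D w u = (w ≟ u) ⊎-dec arc? D w u

ball : ∀ {n} → Digraph n → Fin n → Fin n → Bool
ball D u w = does (inBall? D w u)

ball-injective : ∀ {n} {D : Digraph n} → TwinFree D → ∀ {u v} → (∀ w → ball D u w ≡ ball D v w) → u ≡ v
ball-injective {D = D} twinFree {u} {v} sameBall = decidable-stable (u ≟ v) λ u≢v →
  twinFree u v (u≢v , λ w → does-≡⇒⇔ (inBall? D w u) (inBall? D w v) (sameBall w))

module _ {n} (D : Digraph n) (twinFree : TwinFree D) where
  open SeparatingCoordinates (ball D) (ball-injective {D = D} twinFree)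

  sameTrace⇒agreeOn : ∀ {C u v} → SameTrace D C u v → AgreeOn C u v
  sameTrace⇒agreeOn {u = u} {v} sameTrace {w} w∈C = does-⇔ (sameTrace w w∈C) (inBall? D w u) (inBall? D w v)

  separatingCode : Σ[ C ∈ Subset n ] (IsSeparatingCode D C × ∣ C ∣ ≤ n ∸ 1)
  separatingCode with separatingSubset (allFin n)
  ... | C , size , separates =
    C , (λ u v u≢v sameTrace → u≢v (separates (∈-allFin u) (∈-allFin v) (sameTrace⇒agreeOn sameTrace))) ,
    subst (λ m → ∣ C ∣ ≤ m ∸ 1) (length-tabulate {n = n} id) size

proposition3 : (n : ℕ) (D : Digraph n) → TwinFree D →
    Σ[ C ∈ Subset n ] (IsSeparatingCode D C × ∣ C ∣ ≤ n ∸ 1)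
proposition3 n = separatingCode
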